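{- Let $T$ be an edge-weighted tree rooted at the homebase $r$, with positive edge weights, and let $q\ge 0$. In every cost-optimal strategy exploring $T$, once an agent leaves a subtree $T_v$ ($v\in V(T)$, $v\neq r$), it never comes back to $T_v$.
   Context: Exploration model: let $G=(V,E,w)$ be a connected undirected graph with edge weights $w:E\to\mathbb{R}^+$, a designated vertex (the homebase), and an invoking cost $q\in\mathbb{R}^+\cup\{0\}$. A strategy is a sequence of moves, each either (1) invoking a new agent, which appears at the homebase, or (2) an agent currently at a vertex $u$ traversing an edge $(u,v)$. The number of agents is unbounded and agents need not return to the homebase. The strategy explores $G$ if every vertex is visited by at least one agent. If $k$ agents are invoked and agent $i$ traverses total distance $d_i$ (with multiplicity), the cost is $kq+\sum_i d_i$. A strategy is cost-optimal if it explores $G$ with minimum cost. For a rooted tree $T$ and vertex $v$, $T_v$ is the subtree consisting of $v$ and its descendants and $p(v)$ is the parent of $v$. An agent leaves $T_v$ when it moves from $v$ to $p(v)$, and comes back to $T_v$ when it later moves from $p(v)$ to $v$. -}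

module Defs where

open import Data.Nat using (ℕ; zero; suc) renaming (_≤_ to _≤ℕ_)
open import Data.Fin using (Fin; toℕ; _≟_) renaming (zero to fzero; suc to fsuc)
open import Data.List using (List; []; _∷_; _++_; [_])
open import Data.List.Relation.Unary.Any using (Any)
open import Data.List.Membership.Propositional using (_∈_)
open import Data.Maybe using (Maybe; just; nothing)
import Data.Maybe as Maybe
open import Data.Product using (Σ; _×_; _,_)
open import Data.Sum using (_⊎_)
open import Relation.Nullary using (¬_; yes; no)
open import Relation.Binary.PropositionalEquality using (_≡_)

-- Weights: an arbitrary totally ordered abelian group (ℝ is an instance).
-- Costs are only ever added and compared, so this is the structure needed.

record OrderedAbelianGroup : Set₁ where
  infixl 6 _+_
  infix 4 _<_
  field
    Carrier    : Set
    _+_        : Carrier → Carrier → Carrier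
    0#         : Carrier
    -_         : Carrier → Carrier
    _<_        : Carrier → Carrier → Set
    +-assoc    : ∀ x y z → (x + y) + z ≡ x + (y + z)
    +-comm     : ∀ x y → x + y ≡ y + x
    +-identityˡ : ∀ x → 0# + x ≡ x
    +-inverseˡ : ∀ x → (- x) + x ≡ 0#
    <-irrefl   : ∀ x → ¬ (x < x)
    <-trans    : ∀ {x y z} → x < y → y < z → x < z
    <-tri      : ∀ x y → x < y ⊎ (x ≡ y ⊎ y < x)
    +-monoˡ-<  : ∀ {x y} z → x < y → x + z < y + z

  infix 4 _≤_
  _≤_ : Carrier → Carrier → Set
  x ≤ y = x < y ⊎ x ≡ y

-- Non-root vertex fsuc e has parent (parent e); the edge {fsuc e, parent e}
-- is named by e : Fin n.  The parent has a smaller label, so this is a tree;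
-- every rooted tree admits such a labelling (e.g. BFS order).

record RootedTree (n : ℕ) : Set where
  field
    parent   : Fin n → Fin (suc n)
    parent<  : ∀ e → suc (toℕ (parent e)) ≤ℕ suc (toℕ e)
open RootedTree public

root : ∀ {n} → Fin (suc n)
root = fzero

-- direction of traversal of edge e: up = from fsuc e to its parent
-- (leaving T_{fsuc e}); down = from the parent to fsuc e (coming back).
data Dir : Set where
  up down : Dir

-- A move: invoke a new agent, or agent number a (agents numbered 0,1,..
-- in order of invocation) traverses edge e in direction d.
data Move (n : ℕ) : Set where
  invoke : Move n
  step   : (a : ℕ) (e : Fin n) (d : Dir) → Move n

Strategy : ℕ → Set
Strategy n = List (Move n)

at : ∀ {A : Set} → List A → ℕ → Maybe A
at []       _       = nothing
at (x ∷ xs) zero    = just x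
at (x ∷ xs) (suc i) = at xs i

setAt : ∀ {A : Set} → List A → ℕ → A → List A
setAt []       _       y = []
setAt (x ∷ xs) zero    y = y ∷ xs
setAt (x ∷ xs) (suc i) y = x ∷ setAt xs i y

module _ {n : ℕ} (T : RootedTree n) where

  src tgt : Fin n → Dir → Fin (suc n)
  src e up   = fsuc e
  src e down = parent T e
  tgt e up   = parent T e
  tgt e down = fsuc e

  State : Set
  State = List (Fin (suc n))

  apply : State → Move n → Maybe State
  apply s invoke = just (s ++ [ root ])
  apply s (step a e d) with at s a
  ... | nothing = nothing
  ... | just u with u ≟ src e d
  ...   | yes _ = just (setAt s a (tgt e d))
  ...   | no  _ = nothing

  states : State → Strategy n → Maybe (List State)
  states s []       = just [ s ]
  states s (m ∷ ms) = Maybe._>>=_ (apply s m) (λ s' → Maybe.map (s ∷_) (states s' ms))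

  Explores : Strategy n → Set
  Explores S = Σ (List State) λ sts →
    states [] S ≡ just sts × (∀ (v : Fin (suc n)) → Any (λ s → v ∈ s) sts)

  module _ (G : OrderedAbelianGroup) where
    open OrderedAbelianGroup G

    moveCost : (Fin n → Carrier) → Carrier → Move n → Carrier
    moveCost w q invoke       = q
    moveCost w q (step a e d) = w e

    cost : (Fin n → Carrier) → Carrier → Strategy n → Carrier
    cost w q []       = 0#
    cost w q (m ∷ ms) = moveCost w q m + cost w q ms

    CostOptimal : (Fin n → Carrier) → Carrier → Strategy n → Set
    CostOptimal w q S =
      Explores S × (∀ S' → Explores S' → cost w q S ≤ cost w q S')

-- Suppose agent a leaves T_v (v = fsuc e) by going up e and later goes down e again. It started at
-- the root, outside T_v, so it went down e before; from that moment on its own moves read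
-- down·P·up·B·down, where P is a closed walk at v and B a closed walk at p(v). Moves of the other
-- agents commute with those of a (they change other entries of the state, and whatever the skipped
-- intermediate state occupies is occupied just before or just after), so a's moves may be executed
-- as one block. Replacing that block by B·down·P ends at the same vertex, visits the same vertices
-- and saves 2 w(e) > 0, contradicting optimality.

module Submission where

open import Defs
open import Algebra.Bundles using (CommutativeMonoid)
import Algebra.Properties.CommutativeSemigroup as CommutativeSemigroupProperties
import Algebra.Solver.CommutativeMonoid as CommutativeMonoidSolver
open import Algebra.Structures.Biased using (isCommutativeMonoidˡ)
open import Data.Empty using (⊥; ⊥-elim)
open import Data.Fin using (Fin; _≟_) renaming (zero to fzero; suc to fsuc)
open import Data.List using (List; []; _∷_; _++_; [_]; length; map)
open import Data.List.Membership.Propositional using (_∈_)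
open import Data.List.Membership.Propositional.Properties using (∈-++⁻; ∈-++⁺ʳ; ∈-∃++)
open import Data.List.Properties using (++-assoc; length-++; map-++)
open import Data.List.Relation.Unary.Any using (Any; here; there)
open import Data.Maybe using (Maybe; just; nothing; _>>=_)
import Data.Maybe as Maybe
import Data.Maybe.Properties as Maybe
open import Data.Nat using (ℕ; zero; suc; _<_; z≤n; s≤s) renaming (_≟_ to _≟ℕ_)
open import Data.Nat.Properties using (m≤n⇒m≤n+o)
open import Data.Product using (∃; _×_; _,_; uncurry)
import Data.Product as Product
open import Data.Sum using (_⊎_; inj₁; inj₂; [_,_]′)
import Data.Sum as Sum
open import Data.Vec using ([]; _∷_)
open import Function using (_∘_)
open import Level using (0ℓ)
open import Relation.Binary.PropositionalEquality
  using (_≡_; _≢_; refl; sym; trans; cong; cong₂; subst; subst₂; isEquivalence; module ≡-Reasoning)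
open import Relation.Nullary using (¬_; yes; no)

module _ {A : Set} where

  at⇒< : ∀ (s : List A) i {x} → at s i ≡ just x → i < length s
  at⇒< (y ∷ s) zero    _  = s≤s z≤n
  at⇒< (y ∷ s) (suc i) eq = s≤s (at⇒< s i eq)

  at⇒∈ : ∀ (s : List A) i {x} → at s i ≡ just x → x ∈ s
  at⇒∈ (y ∷ s) zero    refl = here refl
  at⇒∈ (y ∷ s) (suc i) eq   = there (at⇒∈ s i eq)

  length-setAt : ∀ (s : List A) i y → length (setAt s i y) ≡ length s
  length-setAt []      i       y = refl
  length-setAt (x ∷ s) zero    y = refl
  length-setAt (x ∷ s) (suc i) y = cong suc (length-setAt s i y)

  at-setAt≡ : ∀ (s : List A) i y → i < length s → at (setAt s i y) i ≡ just y
  at-setAt≡ (x ∷ s) zero    y _         = refl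
  at-setAt≡ (x ∷ s) (suc i) y (s≤s i<s) = at-setAt≡ s i y i<s

  at-setAt≢ : ∀ (s : List A) {i j} y → i ≢ j → at (setAt s j y) i ≡ at s i
  at-setAt≢ []      {i}     {j}     y i≢j = refl
  at-setAt≢ (x ∷ s) {zero}  {zero}  y i≢j = ⊥-elim (i≢j refl)
  at-setAt≢ (x ∷ s) {zero}  {suc j} y i≢j = refl
  at-setAt≢ (x ∷ s) {suc i} {zero}  y i≢j = refl
  at-setAt≢ (x ∷ s) {suc i} {suc j} y i≢j = at-setAt≢ s y (i≢j ∘ cong suc)

  at-setAt⁻ : ∀ (s : List A) i j y {x} → at (setAt s j y) i ≡ just x →
              (i ≡ j × x ≡ y) ⊎ at s i ≡ just x
  at-setAt⁻ (z ∷ s) zero    zero    y refl = inj₁ (refl , refl)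
  at-setAt⁻ (z ∷ s) zero    (suc j) y eq   = inj₂ eq
  at-setAt⁻ (z ∷ s) (suc i) zero    y eq   = inj₂ eq
  at-setAt⁻ (z ∷ s) (suc i) (suc j) y eq   =
    Sum.map₁ (Product.map₁ (cong suc)) (at-setAt⁻ s i j y eq)

  setAt-at : ∀ (s : List A) i {x} → at s i ≡ just x → setAt s i x ≡ s
  setAt-at (y ∷ s) zero    refl = refl
  setAt-at (y ∷ s) (suc i) eq   = cong (y ∷_) (setAt-at s i eq)

  setAt-setAt : ∀ (s : List A) i x y → setAt (setAt s i x) i y ≡ setAt s i y
  setAt-setAt []      i       x y = refl
  setAt-setAt (z ∷ s) zero    x y = refl
  setAt-setAt (z ∷ s) (suc i) x y = cong (z ∷_) (setAt-setAt s i x y)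

  setAt-comm : ∀ (s : List A) {i j} x y → i ≢ j →
               setAt (setAt s i x) j y ≡ setAt (setAt s j y) i x
  setAt-comm []      {i}     {j}     x y i≢j = refl
  setAt-comm (z ∷ s) {zero}  {zero}  x y i≢j = ⊥-elim (i≢j refl)
  setAt-comm (z ∷ s) {zero}  {suc j} x y i≢j = refl
  setAt-comm (z ∷ s) {suc i} {zero}  x y i≢j = refl
  setAt-comm (z ∷ s) {suc i} {suc j} x y i≢j = cong (z ∷_) (setAt-comm s x y (i≢j ∘ cong suc))

  at-++ˡ : ∀ (s ys : List A) i → i < length s → at (s ++ ys) i ≡ at s i
  at-++ˡ (x ∷ s) ys zero    _         = refl
  at-++ˡ (x ∷ s) ys (suc i) (s≤s i<s) = at-++ˡ s ys i i<s

  setAt-++ˡ : ∀ (s ys : List A) i y → i < length s → setAt (s ++ ys) i y ≡ setAt s i y ++ ys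
  setAt-++ˡ (x ∷ s) ys zero    y _         = refl
  setAt-++ˡ (x ∷ s) ys (suc i) y (s≤s i<s) = cong (x ∷_) (setAt-++ˡ s ys i y i<s)

  at-∷ʳ⁻ : ∀ (s : List A) y i {x} → at (s ++ [ y ]) i ≡ just x → at s i ≡ just x ⊎ x ≡ y
  at-∷ʳ⁻ []      y zero    refl = inj₂ refl
  at-∷ʳ⁻ (z ∷ s) y zero    eq   = inj₁ eq
  at-∷ʳ⁻ (z ∷ s) y (suc i) eq   = at-∷ʳ⁻ s y i eq

  ∈-setAt⁻ : ∀ (s : List A) i y {v} → v ∈ setAt s i y → v ∈ s ⊎ v ≡ y
  ∈-setAt⁻ (z ∷ s) zero    y (here v≡y) = inj₂ v≡y
  ∈-setAt⁻ (z ∷ s) zero    y (there v∈s) = inj₁ (there v∈s)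
  ∈-setAt⁻ (z ∷ s) (suc i) y (here v≡z) = inj₁ (here v≡z)
  ∈-setAt⁻ (z ∷ s) (suc i) y (there v∈) = Sum.map₁ there (∈-setAt⁻ s i y v∈)

  split-at : ∀ (S : List A) t {m} → at S t ≡ just m → ∃ λ S₁ → ∃ λ S₂ → S ≡ S₁ ++ m ∷ S₂
  split-at (x ∷ S) zero    refl = [] , S , refl
  split-at (x ∷ S) (suc t) eq with split-at S t eq
  ... | S₁ , S₂ , refl = x ∷ S₁ , S₂ , refl

  split-at₂ : ∀ (S : List A) t t′ {m m′} → t < t′ → at S t ≡ just m → at S t′ ≡ just m′ →
              ∃ λ S₁ → ∃ λ S₂ → ∃ λ S₃ → S ≡ S₁ ++ m ∷ (S₂ ++ m′ ∷ S₃)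
  split-at₂ (x ∷ S) zero    (suc t′) _         refl eq′ with split-at S t′ eq′
  ... | S₂ , S₃ , refl = [] , S₂ , S₃ , refl
  split-at₂ (x ∷ S) (suc t) (suc t′) (s≤s t<t′) eq eq′ with split-at₂ S t t′ t<t′ eq eq′
  ... | S₁ , S₂ , S₃ , refl = x ∷ S₁ , S₂ , S₃ , refl

  ++-regroup : ∀ (X₁ X₂ S₂ S₃ : List A) x y z →
               (X₁ ++ x ∷ X₂) ++ y ∷ (S₂ ++ z ∷ S₃) ≡ X₁ ++ (x ∷ X₂ ++ y ∷ S₂ ++ [ z ]) ++ S₃
  ++-regroup X₁ X₂ S₂ S₃ x y z = begin
    (X₁ ++ x ∷ X₂) ++ y ∷ S₂ ++ z ∷ S₃
      ≡⟨ ++-assoc X₁ (x ∷ X₂) _ ⟩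
    X₁ ++ x ∷ X₂ ++ y ∷ S₂ ++ z ∷ S₃
      ≡⟨ cong (λ R → X₁ ++ x ∷ X₂ ++ y ∷ R) (sym (++-assoc S₂ [ z ] S₃)) ⟩
    X₁ ++ x ∷ X₂ ++ y ∷ (S₂ ++ [ z ]) ++ S₃
      ≡⟨ cong (λ R → X₁ ++ x ∷ R) (sym (++-assoc X₂ (y ∷ S₂ ++ [ z ]) S₃)) ⟩
    X₁ ++ (x ∷ X₂ ++ y ∷ S₂ ++ [ z ]) ++ S₃
      ∎
    where open ≡-Reasoning

module Run {C I : Set} (next : C → I → Maybe C) where

  run : C → List I → Maybe C
  run c []       = just c
  run c (i ∷ is) = next c i >>= λ c′ → run c′ is

  data Visits (P : C → Set) : C → List I → Set where
    start : ∀ {c is} → P c → Visits P c is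
    later : ∀ {c c′ i is} → next c i ≡ just c′ → Visits P c′ is → Visits P c (i ∷ is)

  run-∷ : ∀ c {c′} i is → next c i ≡ just c′ → run c (i ∷ is) ≡ run c′ is
  run-∷ c i is eq = cong (_>>= λ c′ → run c′ is) eq

  run-∷⁻ : ∀ c i is {f} → run c (i ∷ is) ≡ just f →
           ∃ λ c′ → next c i ≡ just c′ × run c′ is ≡ just f
  run-∷⁻ c i is r with next c i
  ... | just c′ = c′ , refl , r

  run-++ : ∀ c xs ys → run c (xs ++ ys) ≡ (run c xs >>= λ g → run g ys)
  run-++ c []       ys = refl
  run-++ c (i ∷ xs) ys with next c i
  ... | nothing = refl
  ... | just c′ = run-++ c′ xs ys

  run-++⁻ : ∀ c xs ys {f} → run c (xs ++ ys) ≡ just f →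
            ∃ λ g → run c xs ≡ just g × run g ys ≡ just f
  run-++⁻ c xs ys r with run c xs | run-++ c xs ys
  ... | just g  | eq = g , refl , trans (sym eq) r
  ... | nothing | eq with trans (sym eq) r
  ...   | ()

  run-++⁺ : ∀ c xs ys {g f} → run c xs ≡ just g → run g ys ≡ just f → run c (xs ++ ys) ≡ just f
  run-++⁺ c xs ys rxs rys rewrite run-++ c xs ys | rxs = rys

  Visits-∷⁻ : ∀ {P c c′ i is} → next c i ≡ just c′ → Visits P c (i ∷ is) → P c ⊎ Visits P c′ is
  Visits-∷⁻ eq  (start p)       = inj₁ p
  Visits-∷⁻ eq  (later eq′ vis) with trans (sym eq) eq′
  ... | refl = inj₂ vis

  Visits-++⁻ : ∀ {P} c xs {ys g} → run c xs ≡ just g →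
               Visits P c (xs ++ ys) → Visits P c xs ⊎ Visits P g ys
  Visits-++⁻ c []       refl vis             = inj₂ vis
  Visits-++⁻ c (i ∷ xs) r    (start p)       = inj₁ (start p)
  Visits-++⁻ c (i ∷ xs) r    (later eq vis) =
    Sum.map₁ (later eq) (Visits-++⁻ _ xs (trans (sym (run-∷ c i xs eq)) r) vis)

  Visits-++⁺ˡ : ∀ {P c xs ys} → Visits P c xs → Visits P c (xs ++ ys)
  Visits-++⁺ˡ (start p)      = start p
  Visits-++⁺ˡ (later eq vis) = later eq (Visits-++⁺ˡ vis)

  Visits-++⁺ʳ : ∀ {P} c xs {ys g} → run c xs ≡ just g → Visits P g ys → Visits P c (xs ++ ys)
  Visits-++⁺ʳ c []       refl vis = vis
  Visits-++⁺ʳ c (i ∷ xs) r    vis =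
    let c′ , eq , r′ = run-∷⁻ c i xs r in later eq (Visits-++⁺ʳ c′ xs r′ vis)

module Execution {n : ℕ} (T : RootedTree n) where

  open Run (apply T) public

  states⇒run : ∀ s S {sts} → states T s S ≡ just sts →
               ∃ λ f → run s S ≡ just f × (∀ {v} → Any (v ∈_) sts → Visits (v ∈_) s S)
  states⇒run s []      refl = s , refl , λ { (here v∈s) → start v∈s }
  states⇒run s (m ∷ S) eq with apply T s m in step-ok
  ... | just s′ with states T s′ S in eq′
  ...   | just sts′ with eq
  ...     | refl with states⇒run s′ S eq′
  ...       | f , r , vis =
    f , r , λ { (here v∈s) → start v∈s ; (there p) → later step-ok (vis p) }

  run⇒states : ∀ s S {f} → run s S ≡ just f →
               ∃ λ sts → states T s S ≡ just sts × (∀ {v} → Visits (v ∈_) s S → Any (v ∈_) sts)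
  run⇒states s []      refl = [ s ] , refl , λ { (start v∈s) → here v∈s }
  run⇒states s (m ∷ S) r with apply T s m in step-ok
  ... | just s′ with run⇒states s′ S r
  ...   | sts , eq , vis rewrite eq =
    s ∷ sts , refl , [ here , there ∘ vis ]′ ∘ Visits-∷⁻ step-ok

  explores⇒run : ∀ S → Explores T S → ∃ λ f → run [] S ≡ just f × (∀ v → Visits (v ∈_) [] S)
  explores⇒run S (_ , eq , covered) with states⇒run [] S eq
  ... | f , r , vis = f , r , λ v → vis (covered v)

  run⇒explores : ∀ S {f} → run [] S ≡ just f → (∀ v → Visits (v ∈_) [] S) → Explores T S
  run⇒explores S r covered with run⇒states [] S r
  ... | sts , eq , vis = sts , eq , λ v → vis (covered v)

  data Applied (s : State T) : Move n → State T → Set where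
    invoked : Applied s invoke (s ++ [ root ])
    stepped : ∀ {b e d} → at s b ≡ just (src T e d) →
              Applied s (step b e d) (setAt s b (tgt T e d))

  apply⁻ : ∀ s m {s′} → apply T s m ≡ just s′ → Applied s m s′
  apply⁻ s invoke       refl = invoked
  apply⁻ s (step b e d) eq with at s b in at-b
  ... | just u with u ≟ src T e d
  ...   | yes refl with eq
  ...     | refl = stepped at-b

  apply-step : ∀ s {b e d} → at s b ≡ just (src T e d) →
               apply T s (step b e d) ≡ just (setAt s b (tgt T e d))
  apply-step s {b} {e} {d} at-b rewrite at-b with src T e d ≟ src T e d
  ... | yes _ = refl
  ... | no ≢  = ⊥-elim (≢ refl)

  run-++-step⁻ : ∀ s X {Y b e d f} → run s (X ++ step b e d ∷ Y) ≡ just f →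
                 ∃ λ g → run s X ≡ just g × at g b ≡ just (src T e d)
  run-++-step⁻ s X {Y} {b} {e} {d} r with run-++⁻ s X (step b e d ∷ Y) r
  ... | g , rX , rest with apply T g (step b e d) in eq
  ...   | just _ with apply⁻ g _ eq
  ...     | stepped at-b = g , rX , at-b

  infix 4 _⊑⟨_⟩_
  record _⊑⟨_⟩_ (Y : Strategy n) (s : State T) (Y′ : Strategy n) : Set where
    constructor mk⊑
    field
      simulate : ∀ {f} → run s Y ≡ just f →
                 run s Y′ ≡ just f × (∀ {v} → Visits (v ∈_) s Y → Visits (v ∈_) s Y′)
  open _⊑⟨_⟩_ public

  ⊑⟨⟩-refl : ∀ {s Y} → Y ⊑⟨ s ⟩ Y
  ⊑⟨⟩-refl = mk⊑ λ r → r , λ vis → vis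

  ⊑⟨⟩-trans : ∀ {s X Y Z} → X ⊑⟨ s ⟩ Y → Y ⊑⟨ s ⟩ Z → X ⊑⟨ s ⟩ Z
  ⊑⟨⟩-trans X⊑Y Y⊑Z = mk⊑ λ r →
    let r′ , vis = simulate X⊑Y r ; r″ , vis′ = simulate Y⊑Z r′ in r″ , vis′ ∘ vis

  ⊑⟨⟩-∷ : ∀ {s} m {Y Y′} → (∀ {s′} → apply T s m ≡ just s′ → Y ⊑⟨ s′ ⟩ Y′) →
          (m ∷ Y) ⊑⟨ s ⟩ (m ∷ Y′)
  ⊑⟨⟩-∷ m {Y} {Y′} Y⊑Y′ = mk⊑ λ r →
    let s′ , eq , r₁ = run-∷⁻ _ m Y r ; r₁′ , vis = simulate (Y⊑Y′ eq) r₁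
    in trans (run-∷ _ m Y′ eq) r₁′ , [ start , later eq ∘ vis ]′ ∘ Visits-∷⁻ eq

  Visits-swap : ∀ {s s₁ s₂ s₁′ m m′ Z v} →
                apply T s m ≡ just s₁ → apply T s₁ m′ ≡ just s₂ →
                apply T s m′ ≡ just s₁′ → apply T s₁′ m ≡ just s₂ → (v ∈ s₁ → v ∈ s ⊎ v ∈ s₂) →
                Visits (v ∈_) s (m ∷ m′ ∷ Z) → Visits (v ∈_) s (m′ ∷ m ∷ Z)
  Visits-swap eq₁ eq₂ eq₁′ eq₂′ s₁⊆ vis with Visits-∷⁻ eq₁ vis
  ... | inj₁ v∈s  = start v∈s
  ... | inj₂ vis₁ with Visits-∷⁻ eq₂ vis₁
  ...   | inj₁ v∈s₁ = [ start , later eq₁′ ∘ later eq₂′ ∘ start ]′ (s₁⊆ v∈s₁)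
  ...   | inj₂ visZ = later eq₁′ (later eq₂′ visZ)

  ⊑⟨⟩-++ˡ : ∀ {s g} X {Y Y′} → run s X ≡ just g → Y ⊑⟨ g ⟩ Y′ → (X ++ Y) ⊑⟨ s ⟩ (X ++ Y′)
  ⊑⟨⟩-++ˡ []      refl Y⊑Y′ = Y⊑Y′
  ⊑⟨⟩-++ˡ (m ∷ X) rX   Y⊑Y′ =
    ⊑⟨⟩-∷ m λ eq → ⊑⟨⟩-++ˡ X (trans (sym (run-∷ _ m X eq)) rX) Y⊑Y′

  ⊑⟨⟩-++ʳ : ∀ {s Y Y′} Z → Y ⊑⟨ s ⟩ Y′ → (Y ++ Z) ⊑⟨ s ⟩ (Y′ ++ Z)
  ⊑⟨⟩-++ʳ {s} {Y} {Y′} Z Y⊑Y′ = mk⊑ λ r →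
    let g , rY , rZ = run-++⁻ s Y Z r ; rY′ , vis = simulate Y⊑Y′ rY
    in run-++⁺ s Y′ Z rY′ rZ ,
       [ Visits-++⁺ˡ ∘ vis , Visits-++⁺ʳ s Y′ rY′ ]′ ∘ Visits-++⁻ s Y rY

  ⊑⟨⟩-explores : ∀ X {g W W′} Z → run [] X ≡ just g → W ⊑⟨ g ⟩ W′ →
                 Explores T (X ++ W ++ Z) → Explores T (X ++ W′ ++ Z)
  ⊑⟨⟩-explores X {W = W} {W′} Z rX W⊑W′ ex =
    let _ , r , covered = explores⇒run (X ++ W ++ Z) ex
        r′ , vis = simulate (⊑⟨⟩-++ˡ X rX (⊑⟨⟩-++ʳ Z W⊑W′)) r
    in run⇒explores (X ++ W′ ++ Z) r′ (λ v → vis (covered v))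

module Walks {n : ℕ} (T : RootedTree n) where

  Arc : Set
  Arc = Fin n × Dir

  traverse : Fin (suc n) → Arc → Maybe (Fin (suc n))
  traverse u (e , d) with u ≟ src T e d
  ... | yes _ = just (tgt T e d)
  ... | no  _ = nothing

  module Walk = Run traverse

  traverse-src : ∀ e d → traverse (src T e d) (e , d) ≡ just (tgt T e d)
  traverse-src e d with src T e d ≟ src T e d
  ... | yes _ = refl
  ... | no ≢  = ⊥-elim (≢ refl)

  traverse⁻ : ∀ {u u′ e d} → traverse u (e , d) ≡ just u′ → u ≡ src T e d × u′ ≡ tgt T e d
  traverse⁻ {u} {e = e} {d} eq with u ≟ src T e d
  traverse⁻ refl | yes u≡ = u≡ , refl

  walk-∷⁻ : ∀ {u y} e d M → Walk.run u ((e , d) ∷ M) ≡ just y →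
            u ≡ src T e d × Walk.run (tgt T e d) M ≡ just y
  walk-∷⁻ e d M r with Walk.run-∷⁻ _ (e , d) M r
  ... | _ , eq , r′ with traverse⁻ {e = e} {d} eq
  ...   | u≡ , refl = u≡ , r′

  data Below (e : Fin n) : Fin (suc n) → Set where
    top   : Below e (fsuc e)
    child : ∀ {e′} → Below e (parent T e′) → Below e (fsuc e′)

  Below-src : ∀ {e} e′ d′ → Below e (tgt T e′ d′) →
              (e′ ≡ e × d′ ≡ down) ⊎ Below e (src T e′ d′)
  Below-src e′ up   below         = inj₂ (child below)
  Below-src e′ down top           = inj₁ (refl , refl)
  Below-src e′ down (child below) = inj₂ below

  detour shortcut : Fin n → List Arc → List Arc → List Arc
  detour   e P B = (e , down) ∷ P ++ (e , up) ∷ B ++ [ (e , down) ]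
  shortcut e P B = B ++ (e , down) ∷ P

  walk-detour⁻ : ∀ {p y} e P B → Walk.run p (detour e P B) ≡ just y →
                 p ≡ parent T e × y ≡ fsuc e ×
                 Walk.run (fsuc e) P ≡ just (fsuc e) × Walk.run (parent T e) B ≡ just (parent T e)
  walk-detour⁻ {p} e P B r with walk-∷⁻ {p} e down (P ++ (e , up) ∷ B ++ [ (e , down) ]) r
  ... | refl , r₁ with Walk.run-++⁻ (fsuc e) P ((e , up) ∷ B ++ [ (e , down) ]) r₁
  ...   | z₁ , closedP , r₂ with walk-∷⁻ {z₁} e up (B ++ [ (e , down) ]) r₂
  ...     | refl , r₃ with Walk.run-++⁻ (parent T e) B [ (e , down) ] r₃
  ...       | z₂ , closedB , r₄ with walk-∷⁻ {z₂} e down [] r₄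
  ...         | refl , refl = refl , refl , closedP , closedB

  walk-shortcut : ∀ {p y} e P B → Walk.run p (detour e P B) ≡ just y →
                  Walk.run p (shortcut e P B) ≡ just y ×
                  (∀ {v} → Walk.Visits (v ≡_) p (detour e P B) →
                           Walk.Visits (v ≡_) p (shortcut e P B))
  walk-shortcut {p} e P B r with walk-detour⁻ {p} e P B r
  ... | refl , refl , closedP , closedB = Walk.run-++⁺ _ B _ closedB enterP , onShortcut
    where
      enterP : Walk.run (parent T e) ((e , down) ∷ P) ≡ just (fsuc e)
      enterP = trans (Walk.run-∷ _ (e , down) P (traverse-src e down)) closedP

      viaP : ∀ {v} → Walk.Visits (v ≡_) (fsuc e) P →
                     Walk.Visits (v ≡_) (parent T e) (shortcut e P B)
      viaP = Walk.Visits-++⁺ʳ _ B closedB ∘ Walk.later (traverse-src e down)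

      onShortcut : ∀ {v} → Walk.Visits (v ≡_) (parent T e) (detour e P B) →
                   Walk.Visits (v ≡_) (parent T e) (shortcut e P B)
      onShortcut vis with Walk.Visits-∷⁻ (traverse-src e down) vis
      ... | inj₁ refl = Walk.start refl
      ... | inj₂ vis₁ with Walk.Visits-++⁻ _ P closedP vis₁
      ...   | inj₁ onP = viaP onP
      ...   | inj₂ vis₂ with Walk.Visits-∷⁻ (traverse-src e up) vis₂
      ...     | inj₁ refl = viaP (Walk.start refl)
      ...     | inj₂ vis₃ with Walk.Visits-++⁻ _ B closedB vis₃
      ...       | inj₁ onB = Walk.Visits-++⁺ˡ onB
      ...       | inj₂ vis₄ with Walk.Visits-∷⁻ (traverse-src e down) vis₄
      ...         | inj₁ refl = Walk.start refl
      ...         | inj₂ (Walk.start refl) = viaP (Walk.start refl)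

module Agent {n : ℕ} (T : RootedTree n) (a : ℕ) where

  open Execution T
  open Walks T

  -- Only from states where agent a exists: an invoke creating a would not commute with a's moves.
  infix 4 _⊑_
  _⊑_ : Strategy n → Strategy n → Set
  Y ⊑ Y′ = ∀ s → a < length s → Y ⊑⟨ s ⟩ Y′

  apply-keeps-agent : ∀ s m {s′} → apply T s m ≡ just s′ → a < length s → a < length s′
  apply-keeps-agent s m eq a<s with apply⁻ s m eq
  ... | invoked   = subst (a <_) (sym (length-++ s)) (m≤n⇒m≤n+o 1 a<s)
  ... | stepped _ = subst (a <_) (sym (length-setAt s _ _)) a<s

  ⊑-trans : ∀ {X Y Z} → X ⊑ Y → Y ⊑ Z → X ⊑ Z
  ⊑-trans X⊑Y Y⊑Z s a<s = ⊑⟨⟩-trans (X⊑Y s a<s) (Y⊑Z s a<s)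

  ⊑-∷ : ∀ m {Y Y′} → Y ⊑ Y′ → (m ∷ Y) ⊑ (m ∷ Y′)
  ⊑-∷ m Y⊑Y′ s a<s = ⊑⟨⟩-∷ m λ eq → Y⊑Y′ _ (apply-keeps-agent s m eq a<s)

  data ByOther : Move n → Set where
    other-invoke : ByOther invoke
    other-step   : ∀ {b} e d → b ≢ a → ByOther (step b e d)

  apply-commute : ∀ s {m e d s₁ s₂} → ByOther m → a < length s →
    apply T s m ≡ just s₁ → apply T s₁ (step a e d) ≡ just s₂ →
    ∃ λ s₁′ → apply T s (step a e d) ≡ just s₁′ × apply T s₁′ m ≡ just s₂ ×
              (∀ {v} → v ∈ s₁ → v ∈ s ⊎ v ∈ s₂)
  apply-commute s {e = e} {d} other-invoke a<s eq₁ eq₂ with apply⁻ s invoke eq₁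
  ... | invoked with apply⁻ (s ++ [ root ]) _ eq₂
  ...   | stepped at-a =
    setAt s a (tgt T e d) ,
    apply-step s (trans (sym (at-++ˡ s [ root ] a a<s)) at-a) ,
    cong just (sym s₂≡) ,
    Sum.map₂ root∈s₂ ∘ ∈-++⁻ s
    where
      s₂≡ : setAt (s ++ [ root ]) a (tgt T e d) ≡ setAt s a (tgt T e d) ++ [ root ]
      s₂≡ = setAt-++ˡ s [ root ] a (tgt T e d) a<s
      root∈s₂ : ∀ {v} → v ∈ [ root ] → v ∈ setAt (s ++ [ root ]) a (tgt T e d)
      root∈s₂ (here refl) = subst (root ∈_) (sym s₂≡) (∈-++⁺ʳ _ (here refl))
  apply-commute s {e = e} {d} (other-step {b} e′ d′ b≢a) a<s eq₁ eq₂ with apply⁻ s _ eq₁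
  ... | stepped at-b with apply⁻ (setAt s b (tgt T e′ d′)) (step a e d) eq₂
  ...   | stepped at-a =
    setAt s a (tgt T e d) ,
    apply-step s (trans (sym (at-setAt≢ s _ a≢b)) at-a) ,
    trans (apply-step _ (trans (at-setAt≢ s _ b≢a) at-b)) (cong just (setAt-comm s _ _ a≢b)) ,
    Sum.map₂ (λ { refl → at⇒∈ _ b moved-b }) ∘ ∈-setAt⁻ s b _
    where
      a≢b : a ≢ b
      a≢b = b≢a ∘ sym
      moved-b : at (setAt (setAt s b (tgt T e′ d′)) a (tgt T e d)) b ≡ just (tgt T e′ d′)
      moved-b = trans (at-setAt≢ (setAt s b (tgt T e′ d′)) _ b≢a)
                      (at-setAt≡ s b _ (at⇒< s b at-b))

  swap : ∀ {m} e d {Z} → ByOther m → (m ∷ step a e d ∷ Z) ⊑ (step a e d ∷ m ∷ Z)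
  swap {m} e d {Z} other s a<s = mk⊑ λ r →
    let s₁ , eq₁ , r₁ = run-∷⁻ s m (step a e d ∷ Z) r
        s₂ , eq₂ , r₂ = run-∷⁻ s₁ (step a e d) Z r₁
        _ , eq₁′ , eq₂′ , s₁⊆ = apply-commute s other a<s eq₁ eq₂
    in trans (run-∷ s (step a e d) (m ∷ Z) eq₁′) (trans (run-∷ _ m Z eq₂′) r₂) ,
       Visits-swap eq₁ eq₂ eq₁′ eq₂′ s₁⊆

  byA : List Arc → Strategy n
  byA = map (uncurry (step a))

  ownArcs : Strategy n → List Arc
  ownArcs []               = []
  ownArcs (invoke ∷ S)     = ownArcs S
  ownArcs (step b e d ∷ S) with b ≟ℕ a
  ... | yes _ = (e , d) ∷ ownArcs S
  ... | no  _ = ownArcs S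

  others : Strategy n → Strategy n
  others []               = []
  others (invoke ∷ S)     = invoke ∷ others S
  others (step b e d ∷ S) with b ≟ℕ a
  ... | yes _ = others S
  ... | no  _ = step b e d ∷ others S

  push : ∀ {m} M {N} → ByOther m → (m ∷ byA M ++ N) ⊑ (byA M ++ m ∷ N)
  push []            other s a<s = ⊑⟨⟩-refl
  push ((e , d) ∷ M) other       = ⊑-trans (swap e d other) (⊑-∷ (step a e d) (push M other))

  ⊑-ownFirst : ∀ Y → Y ⊑ (byA (ownArcs Y) ++ others Y)
  ⊑-ownFirst []               s a<s = ⊑⟨⟩-refl
  ⊑-ownFirst (invoke ∷ Y)           =
    ⊑-trans (⊑-∷ invoke (⊑-ownFirst Y)) (push (ownArcs Y) other-invoke)
  ⊑-ownFirst (step b e d ∷ Y) with b ≟ℕ a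
  ... | yes refl = ⊑-∷ (step b e d) (⊑-ownFirst Y)
  ... | no  b≢a  =
    ⊑-trans (⊑-∷ (step b e d) (⊑-ownFirst Y)) (push (ownArcs Y) (other-step e d b≢a))

  ownArcs-++ : ∀ X Y → ownArcs (X ++ Y) ≡ ownArcs X ++ ownArcs Y
  ownArcs-++ []               Y = refl
  ownArcs-++ (invoke ∷ X)     Y = ownArcs-++ X Y
  ownArcs-++ (step b e d ∷ X) Y with b ≟ℕ a
  ... | yes _ = cong ((e , d) ∷_) (ownArcs-++ X Y)
  ... | no  _ = ownArcs-++ X Y

  ownArcs-own : ∀ e d Y → ownArcs (step a e d ∷ Y) ≡ (e , d) ∷ ownArcs Y
  ownArcs-own e d Y with a ≟ℕ a
  ... | yes _   = refl
  ... | no  a≢a = ⊥-elim (a≢a refl)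

  revisit : Fin n → Strategy n → Strategy n → Strategy n
  revisit e X₂ S₂ = step a e down ∷ X₂ ++ step a e up ∷ S₂ ++ [ step a e down ]

  improved : Fin n → Strategy n → Strategy n → Strategy n
  improved e X₂ S₂ = byA (shortcut e (ownArcs X₂) (ownArcs S₂)) ++ others (revisit e X₂ S₂)

  ownArcs-revisit : ∀ e X₂ S₂ → ownArcs (revisit e X₂ S₂) ≡ detour e (ownArcs X₂) (ownArcs S₂)
  ownArcs-revisit e X₂ S₂
    rewrite ownArcs-own e down (X₂ ++ step a e up ∷ S₂ ++ [ step a e down ])
          | ownArcs-++ X₂ (step a e up ∷ S₂ ++ [ step a e down ])
          | ownArcs-own e up (S₂ ++ [ step a e down ])
          | ownArcs-++ S₂ [ step a e down ]
          | ownArcs-own e down []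
          = refl

  apply-own : ∀ s e d {u} → at s a ≡ just u →
              apply T s (step a e d) ≡ Maybe.map (setAt s a) (traverse u (e , d))
  apply-own s e d {u} at-a rewrite at-a with u ≟ src T e d
  ... | yes _ = refl
  ... | no  _ = refl

  run-byA : ∀ s M {u} → at s a ≡ just u → run s (byA M) ≡ Maybe.map (setAt s a) (Walk.run u M)
  run-byA s []            at-a = cong just (sym (setAt-at s a at-a))
  run-byA s ((e , d) ∷ M) {u} at-a rewrite apply-own s e d at-a with traverse u (e , d)
  ... | nothing = refl
  ... | just u′ = trans (run-byA (setAt s a u′) M (at-setAt≡ s a u′ (at⇒< s a at-a)))
                        (Maybe.map-cong (setAt-setAt s a u′) (Walk.run u′ M))

  run-byA⁻ : ∀ s M {u f} → at s a ≡ just u → run s (byA M) ≡ just f →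
             ∃ λ y → Walk.run u M ≡ just y × f ≡ setAt s a y
  run-byA⁻ s M {u} at-a r with Walk.run u M | run-byA s M at-a
  ... | just y  | eq = y , refl , Maybe.just-injective (trans (sym r) eq)
  ... | nothing | eq with trans (sym r) eq
  ...   | ()

  Visits-byA⁻ : ∀ s M {u v} → at s a ≡ just u →
                Visits (v ∈_) s (byA M) → v ∈ s ⊎ Walk.Visits (v ≡_) u M
  Visits-byA⁻ s []            at-a (start v∈s)    = inj₁ v∈s
  Visits-byA⁻ s (_ ∷ M)       at-a (start v∈s)    = inj₁ v∈s
  Visits-byA⁻ s ((e , d) ∷ M) at-a (later eq vis) with apply⁻ s _ eq
  ... | stepped at-a′ with trans (sym at-a) at-a′
  ...   | refl with Visits-byA⁻ _ M (at-setAt≡ s a _ (at⇒< s a at-a)) vis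
  ...     | inj₂ onM  = inj₂ (Walk.later (traverse-src e d) onM)
  ...     | inj₁ v∈s′ = Sum.map₂ (λ { refl → Walk.later (traverse-src e d) (Walk.start refl) })
                                 (∈-setAt⁻ s a _ v∈s′)

  Visits-byA⁺ : ∀ s M {u v} → at s a ≡ just u →
                Walk.Visits (v ≡_) u M → Visits (v ∈_) s (byA M)
  Visits-byA⁺ s M             at-a (Walk.start refl)   = start (at⇒∈ s a at-a)
  Visits-byA⁺ s ((e , d) ∷ M) at-a (Walk.later eq onM) with traverse⁻ eq
  ... | refl , refl =
    later (apply-step s at-a) (Visits-byA⁺ _ M (at-setAt≡ s a _ (at⇒< s a at-a)) onM)

  byA-detour⊑shortcut : ∀ s {u} e P B → at s a ≡ just u →
                        byA (detour e P B) ⊑⟨ s ⟩ byA (shortcut e P B)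
  byA-detour⊑shortcut s e P B at-a = mk⊑ λ r →
    let y , closed , f≡ = run-byA⁻ s (detour e P B) at-a r
        walk≡ , onShortcut = walk-shortcut e P B closed
    in trans (run-byA s (shortcut e P B) at-a)
             (trans (cong (Maybe.map (setAt s a)) walk≡) (cong just (sym f≡))) ,
       [ start , Visits-byA⁺ s (shortcut e P B) at-a ∘ onShortcut ]′
         ∘ Visits-byA⁻ s (detour e P B) at-a

  revisit⊑improved : ∀ {g} e X₂ S₂ → at g a ≡ just (parent T e) →
                     revisit e X₂ S₂ ⊑⟨ g ⟩ improved e X₂ S₂
  revisit⊑improved {g} e X₂ S₂ at-a =
    ⊑⟨⟩-trans (subst (λ M → revisit e X₂ S₂ ⊑⟨ g ⟩ byA M ++ others (revisit e X₂ S₂))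
                     (ownArcs-revisit e X₂ S₂)
                     (⊑-ownFirst (revisit e X₂ S₂) g (at⇒< g a at-a)))
              (⊑⟨⟩-++ʳ (others (revisit e X₂ S₂)) (byA-detour⊑shortcut g e _ _ at-a))

  entered-before : ∀ s X {g x} e → run s X ≡ just g → at g a ≡ just x → Below e x →
                   step a e down ∈ X ⊎ ∃ λ y → at s a ≡ just y × Below e y
  entered-before s []      e refl at-a below = inj₂ (_ , at-a , below)
  entered-before s (m ∷ X) e r    at-a below with run-∷⁻ s m X r
  ... | s′ , eq , r′ with entered-before s′ X e r′ at-a below
  ...   | inj₁ down∈X = inj₁ (there down∈X)
  ...   | inj₂ (y , at-y , below-y) with apply⁻ s m eq
  ...     | invoked with at-∷ʳ⁻ s root a at-y
  ...       | inj₁ at-s = inj₂ (y , at-s , below-y)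
  ...       | inj₂ refl with below-y
  ...         | ()
  entered-before s (m ∷ X) e r at-a below | s′ , eq , r′ | inj₂ (y , at-y , below-y)
    | stepped {b} {e′} {d′} at-b with at-setAt⁻ s a b _ at-y
  ... | inj₂ at-s           = inj₂ (y , at-s , below-y)
  ... | inj₁ (refl , refl) with Below-src e′ d′ below-y
  ...   | inj₁ (refl , refl) = inj₁ (here refl)
  ...   | inj₂ below-src     = inj₂ (_ , at-b , below-src)

module Cost (G : OrderedAbelianGroup) {n : ℕ} (T : RootedTree n)
            (w : Fin n → OrderedAbelianGroup.Carrier G) (q : OrderedAbelianGroup.Carrier G) where

  open OrderedAbelianGroup G renaming (_<_ to _<ᴳ_)

  +-commutativeMonoid : CommutativeMonoid 0ℓ 0ℓ
  +-commutativeMonoid = record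
    { Carrier             = Carrier
    ; _≈_                 = _≡_
    ; _∙_                 = _+_
    ; ε                   = 0#
    ; isCommutativeMonoid = isCommutativeMonoidˡ record
      { isSemigroup = record
        { isMagma = record { isEquivalence = isEquivalence ; ∙-cong = cong₂ _+_ }
        ; assoc   = +-assoc
        }
      ; identityˡ = +-identityˡ
      ; comm      = +-comm
      }
    }

  open CommutativeSemigroupProperties (CommutativeMonoid.commutativeSemigroup +-commutativeMonoid)
    using (x∙yz≈y∙xz; xy∙z≈xz∙y)

  x<x+y : ∀ x {y} → 0# <ᴳ y → x <ᴳ x + y
  x<x+y x {y} 0<y = subst₂ _<ᴳ_ (+-identityˡ x) (+-comm y x) (+-monoˡ-< x 0<y)

  open Walks T
  open ≡-Reasoning

  costOf : Strategy n → Carrier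
  costOf = cost T G w q

  cost-++ : ∀ X Y → costOf (X ++ Y) ≡ costOf X + costOf Y
  cost-++ []      Y = sym (+-identityˡ _)
  cost-++ (m ∷ X) Y = trans (cong (moveCost T G w q m +_) (cost-++ X Y)) (sym (+-assoc _ _ _))

  cost-++-middle : ∀ X {W W′} Z {c} → costOf W ≡ costOf W′ + c →
                   costOf (X ++ W ++ Z) ≡ costOf (X ++ W′ ++ Z) + c
  cost-++-middle X {W} {W′} Z {c} W≡W′+c = begin
    costOf (X ++ W ++ Z)                      ≡⟨ split W ⟩
    costOf X + (costOf W + costOf Z)          ≡⟨ cong (λ y → costOf X + (y + costOf Z)) W≡W′+c ⟩
    costOf X + ((costOf W′ + c) + costOf Z)   ≡⟨ cong (costOf X +_) (xy∙z≈xz∙y _ _ _) ⟩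
    costOf X + ((costOf W′ + costOf Z) + c)   ≡⟨ sym (+-assoc _ _ _) ⟩
    (costOf X + (costOf W′ + costOf Z)) + c   ≡⟨ cong (_+ c) (sym (split W′)) ⟩
    costOf (X ++ W′ ++ Z) + c                 ∎
    where
      split : ∀ V → costOf (X ++ V ++ Z) ≡ costOf X + (costOf V + costOf Z)
      split V = trans (cost-++ X _) (cong (costOf X +_) (cost-++ V Z))

  improvement⇒¬CostOptimal : ∀ S S′ {c} → CostOptimal T G w q S → Explores T S′ →
                             costOf S ≡ costOf S′ + c → 0# <ᴳ c → ⊥
  improvement⇒¬CostOptimal S S′ (_ , optimal) explores′ S≡S′+c 0<c =
    <-irrefl _ (S′<S′ (optimal S′ explores′))
    where
      S′<S : costOf S′ <ᴳ costOf S
      S′<S = subst (costOf S′ <ᴳ_) (sym S≡S′+c) (x<x+y _ 0<c)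
      S′<S′ : costOf S ≤ costOf S′ → costOf S′ <ᴳ costOf S′
      S′<S′ (inj₁ S<S′) = <-trans S′<S S<S′
      S′<S′ (inj₂ S≡S′) = subst (costOf S′ <ᴳ_) S≡S′ S′<S

  module _ (a : ℕ) where

    open Agent T a

    cost-ownFirst : ∀ Y → costOf Y ≡ costOf (byA (ownArcs Y)) + costOf (others Y)
    cost-ownFirst []               = sym (+-identityˡ _)
    cost-ownFirst (invoke ∷ Y)     = trans (cong (q +_) (cost-ownFirst Y)) (x∙yz≈y∙xz _ _ _)
    cost-ownFirst (step b e d ∷ Y) with b ≟ℕ a
    ... | yes _ = trans (cong (w e +_) (cost-ownFirst Y)) (sym (+-assoc _ _ _))
    ... | no  _ = trans (cong (w e +_) (cost-ownFirst Y)) (x∙yz≈y∙xz _ _ _)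

    cost-byA-++ : ∀ M N → costOf (byA (M ++ N)) ≡ costOf (byA M) + costOf (byA N)
    cost-byA-++ M N = trans (cong costOf (map-++ _ M N)) (cost-++ (byA M) (byA N))

    cost-detour : ∀ e P B →
                  costOf (byA (detour e P B)) ≡ costOf (byA (shortcut e P B)) + (w e + w e)
    cost-detour e P B = begin
      costOf (byA (detour e P B))
        ≡⟨ cong (w e +_) (trans (cost-byA-++ P _)
                                (cong (λ y → costOf (byA P) + (w e + y)) (cost-byA-++ B _))) ⟩
      w e + (costOf (byA P) + (w e + (costOf (byA B) + (w e + 0#))))
        ≡⟨ regroup (w e) (costOf (byA P)) (costOf (byA B)) ⟩
      (costOf (byA B) + (w e + costOf (byA P))) + (w e + w e)
        ≡⟨ cong (_+ (w e + w e)) (sym (cost-byA-++ B _)) ⟩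
      costOf (byA (shortcut e P B)) + (w e + w e)
        ∎
      where
        open CommutativeMonoidSolver +-commutativeMonoid
        regroup : ∀ x p b → x + (p + (x + (b + (x + 0#)))) ≡ (b + (x + p)) + (x + x)
        regroup x p b = prove 3 (X ⊕ (P′ ⊕ (X ⊕ (B′ ⊕ (X ⊕ id))))) ((B′ ⊕ (X ⊕ P′)) ⊕ (X ⊕ X))
                                (x ∷ p ∷ b ∷ [])
          where
            X P′ B′ : Expr 3
            X  = var fzero
            P′ = var (fsuc fzero)
            B′ = var (fsuc (fsuc fzero))

    cost-revisit : ∀ e X₂ S₂ →
                   costOf (revisit e X₂ S₂) ≡ costOf (improved e X₂ S₂) + (w e + w e)
    cost-revisit e X₂ S₂ = begin
      costOf (revisit e X₂ S₂)
        ≡⟨ cost-ownFirst (revisit e X₂ S₂) ⟩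
      costOf (byA (ownArcs (revisit e X₂ S₂))) + costOf O
        ≡⟨ cong (λ M → costOf (byA M) + costOf O) (ownArcs-revisit e X₂ S₂) ⟩
      costOf (byA (detour e P B)) + costOf O
        ≡⟨ cong (_+ costOf O) (cost-detour e P B) ⟩
      (costOf (byA (shortcut e P B)) + c) + costOf O
        ≡⟨ xy∙z≈xz∙y _ _ _ ⟩
      (costOf (byA (shortcut e P B)) + costOf O) + c
        ≡⟨ cong (_+ c) (sym (cost-++ (byA (shortcut e P B)) O)) ⟩
      costOf (improved e X₂ S₂) + c
        ∎
      where
        O : Strategy n
        O = others (revisit e X₂ S₂)
        P B : List Arc
        P = ownArcs X₂
        B = ownArcs S₂
        c : Carrier
        c = w e + w e

module Revisit (G : OrderedAbelianGroup) {n : ℕ} (T : RootedTree n)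
               (w : Fin n → OrderedAbelianGroup.Carrier G) (q : OrderedAbelianGroup.Carrier G)
               (a : ℕ) (e : Fin n) where

  open OrderedAbelianGroup G renaming (_<_ to _<ᴳ_)
  open Execution T
  open Walks T
  open Agent T a
  open Cost G T w q

  revisit-not-optimal : (∀ e → 0# <ᴳ w e) →
                        ∀ X₁ X₂ S₂ S₃ → ¬ CostOptimal T G w q (X₁ ++ revisit e X₂ S₂ ++ S₃)
  revisit-not-optimal w>0 X₁ X₂ S₂ S₃ optimal@(explores , _) =
    let _ , ran , _ = explores⇒run (X₁ ++ revisit e X₂ S₂ ++ S₃) explores
        _ , ranX₁ , at-a = run-++-step⁻ [] X₁ ran
    in improvement⇒¬CostOptimal (X₁ ++ revisit e X₂ S₂ ++ S₃) (X₁ ++ improved e X₂ S₂ ++ S₃) optimal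
         (⊑⟨⟩-explores X₁ S₃ ranX₁ (revisit⊑improved e X₂ S₂ at-a) explores)
         (cost-++-middle X₁ S₃ (cost-revisit a e X₂ S₂))
         (<-trans (w>0 e) (x<x+y (w e) (w>0 e)))

  optimal-never-returns : (∀ e → 0# <ᴳ w e) →
    ∀ S₁ S₂ S₃ → ¬ CostOptimal T G w q (S₁ ++ step a e up ∷ S₂ ++ step a e down ∷ S₃)
  optimal-never-returns w>0 S₁ S₂ S₃ optimal@(explores , _)
    with _ , ran , _ ← explores⇒run (S₁ ++ step a e up ∷ S₂ ++ step a e down ∷ S₃) explores
    with _ , ranS₁ , at-child ← run-++-step⁻ [] S₁ {e = e} {up} ran
    with entered-before [] S₁ e ranS₁ at-child top
  ... | inj₂ (_ , () , _)
  ... | inj₁ entered with X₁ , X₂ , refl ← ∈-∃++ entered =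
    revisit-not-optimal w>0 X₁ X₂ S₂ S₃
      (subst (CostOptimal T G w q) (++-regroup X₁ X₂ S₂ S₃ _ _ _) optimal)

mainTheorem5 : (G : OrderedAbelianGroup) (n : ℕ) (T : RootedTree n)
    (w : Fin n → OrderedAbelianGroup.Carrier G) →
    (∀ e → OrderedAbelianGroup._<_ G (OrderedAbelianGroup.0# G) (w e)) →
    (q : OrderedAbelianGroup.Carrier G) →
    OrderedAbelianGroup._≤_ G (OrderedAbelianGroup.0# G) q →
    (S : Strategy n) → CostOptimal T G w q S →
    (e : Fin n) (a t t' : ℕ) → t < t' →
    at S t ≡ just (step a e up) →
    at S t' ≢ just (step a e down)
mainTheorem5 G n T w w>0 q _ S optimal e a t t′ t<t′ up-at-t down-at-t′
  with S₁ , S₂ , S₃ , refl ← split-at₂ S t t′ t<t′ up-at-t down-at-t′ =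
  Revisit.optimal-never-returns G T w q a e w>0 S₁ S₂ S₃ optimal
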